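{- Let $t\geq 2$, $r\geq 1$, $n_1,n_2\geq 1$ be integers. Suppose the edges of $K_{n_1,n_2}$, with vertex set $U\sqcup V$, $U=\{u_1,\dots,u_{n_1}\}$, $V=\{v_1,\dots,v_{n_2}\}$, are colored with $r$ colors such that there is no monochromatic and no rainbow subgraph isomorphic to $K_{2,t}$. Then there is at most one vertex $u_i\in U$ which is not incident to at least $\frac{n_2-(t-1)(r+1)}{4(t-1)}$ edges of one and the same color.
   Context: A subgraph is monochromatic if all its edges have the same color and rainbow if all its edges have pairwise distinct colors. -}

module Defs where

open import Data.Nat using (ℕ)
open import Data.Fin using (Fin; _≟_)
open import Data.List using (length; filter; allFin)
open import Data.Product using (∃; _×_)
open import Function.Definitions using (Injective)
open import Relation.Binary.PropositionalEquality using (_≡_)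

Colouring : ℕ → ℕ → ℕ → Set
Colouring n₁ n₂ r = Fin n₁ → Fin n₂ → Fin r

Mono : ∀ {r t} → (Fin 2 → Fin t → Fin r) → Set
Mono {r} e = ∃ λ (col : Fin r) → ∀ p k → e p k ≡ col

Rainbow : ∀ {r t} → (Fin 2 → Fin t → Fin r) → Set
Rainbow e = ∀ p k q l → e p k ≡ e q l → (p ≡ q × k ≡ l)

edgesUV : ∀ {n₁ n₂ r t} → Colouring n₁ n₂ r → (Fin 2 → Fin n₁) → (Fin t → Fin n₂)
        → Fin 2 → Fin t → Fin r
edgesUV c x y p k = c (x p) (y k)

edgesVU : ∀ {n₁ n₂ r t} → Colouring n₁ n₂ r → (Fin 2 → Fin n₂) → (Fin t → Fin n₁)
        → Fin 2 → Fin t → Fin r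
edgesVU c x y p k = c (y k) (x p)

NoMonoNoRainbowK2t : ∀ {n₁ n₂ r} → ℕ → Colouring n₁ n₂ r → Set
NoMonoNoRainbowK2t {n₁} {n₂} t c =
  (∀ (x : Fin 2 → Fin n₁) (y : Fin t → Fin n₂) →
     Injective _≡_ _≡_ x → Injective _≡_ _≡_ y →
     ¬' (Mono (edgesUV c x y)) × ¬' (Rainbow (edgesUV c x y)))
  ×
  (∀ (x : Fin 2 → Fin n₂) (y : Fin t → Fin n₁) →
     Injective _≡_ _≡_ x → Injective _≡_ _≡_ y →
     ¬' (Mono (edgesVU c x y)) × ¬' (Rainbow (edgesVU c x y)))
  where
  open import Relation.Nullary using (¬_)
  ¬' : Set → Set
  ¬' A = ¬ A

colDeg : ∀ {n₁ n₂ r} → Colouring n₁ n₂ r → Fin n₁ → Fin r → ℕ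
colDeg {n₂ = n₂} c u col = length (filter (λ v → c u v ≟ col) (allFin n₂))

{-# OPTIONS --safe #-}
module Submission where

open import Defs
open import Data.Empty using (⊥-elim)
open import Data.Fin using (Fin; zero; suc; _≟_; inject≤)
open import Data.Fin.Properties using (any?; inject≤-injective; ¬∀⟶∃¬)
open import Data.List using (List; []; _∷_; length; filter; allFin; lookup)
open import Data.List.Properties using (filter-all; filter-none; length-tabulate)
open import Data.List.Membership.Propositional.Properties using (∈-lookup)
open import Data.List.Relation.Unary.All as All using ()
open import Data.List.Relation.Unary.All.Properties using (all-filter)
open import Data.List.Relation.Unary.AllPairs using (_∷_)
open import Data.List.Relation.Unary.Unique.Propositional using (Unique)
open import Data.List.Relation.Unary.Unique.Propositional.Properties as Unique using (allFin⁺)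
open import Data.List.Relation.Binary.Sublist.Propositional using (⊆-refl)
open import Data.List.Relation.Binary.Sublist.Propositional.Properties using (length-mono-≤; filter⁺)
open import Data.Nat using (ℕ; zero; suc; _≤_; _<_; _+_; _*_; _∸_; z≤n; s≤s; NonZero)
open import Data.Nat.Properties hiding (_≟_)
open import Data.Nat.DivMod using (_/_; m/n*n≤m; m*n/n≡m; /-monoˡ-≤)
open import Data.Nat.Tactic.RingSolver using (solve-∀)
open import Data.Product as Product using (∃; Σ; _×_; _,_; proj₁; proj₂)
open import Data.Sum using (inj₁; inj₂)
import Data.Vec.Functional as Vector
open import Function using (_∘_)
open import Function.Definitions using (Injective)
open import Level using (0ℓ)
open import Relation.Nullary using (¬_; yes; no; contradiction)
open import Relation.Nullary.Decidable using (_×-dec_)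
open import Relation.Unary using (Pred; Decidable; _⊆_; _∪_)
open import Relation.Unary.Properties using (_∪?_)
open import Relation.Binary.PropositionalEquality

-- Let u₁ ≠ u₂ in U have all colour degrees at most B. Grow a rainbow K_{2,k} with 2-side
-- {u₁, u₂} one vertex v ∈ V at a time. A vertex v is unusable only if c(u₁v) = c(u₂v), which
-- happens for at most s = t - 1 vertices per colour (else there is a monochromatic K_{2,t}),
-- or if c(uₚv) repeats one of the 2k colours used so far, which happens for at most 4kB
-- vertices. For k ≤ s this excludes at most rs + 4sB < n₂ vertices, so the growth reaches
-- k = t and produces a rainbow K_{2,t}.

count : {A : Set} {P : Pred A 0ℓ} → Decidable P → List A → ℕ
count P? = length ∘ filter P?

module _ {A : Set} where

  count-mono : {P Q : Pred A 0ℓ} (P? : Decidable P) (Q? : Decidable Q) →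
               P ⊆ Q → ∀ xs → count P? xs ≤ count Q? xs
  count-mono P? Q? P⊆Q xs = length-mono-≤ (filter⁺ P? Q? (λ { refl → P⊆Q }) (⊆-refl {x = xs}))

  count-∪ : {P Q : Pred A 0ℓ} (P? : Decidable P) (Q? : Decidable Q) →
            ∀ xs → count (P? ∪? Q?) xs ≤ count P? xs + count Q? xs
  count-∪ P? Q? [] = z≤n
  count-∪ P? Q? (x ∷ xs) with P? x | Q? x
  ... | yes _ | no _  = s≤s (count-∪ P? Q? xs)
  ... | yes _ | yes _ = s≤s (≤-trans (count-∪ P? Q? xs) (+-monoʳ-≤ (count P? xs) (n≤1+n _)))
  ... | no _  | yes _ = ≤-trans (s≤s (count-∪ P? Q? xs)) (≤-reflexive (sym (+-suc _ _)))
  ... | no _  | no _  = count-∪ P? Q? xs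

  count-∃ : ∀ {m} {Q : Fin m → Pred A 0ℓ} (Q? : ∀ a → Decidable (Q a)) {B} xs →
            (∀ a → count (Q? a) xs ≤ B) → count (λ v → any? λ a → Q? a v) xs ≤ m * B
  count-∃ {zero} Q? xs _ =
    ≤-reflexive (cong length (filter-none _ (All.universal (λ _ → λ { (() , _) }) xs)))
  count-∃ {suc m} {Q} Q? {B} xs bound = begin
    count (λ v → any? λ a → Q? a v) xs                        ≤⟨ count-mono _ _ split xs ⟩
    count (Q? zero ∪? λ v → any? λ a → Q? (suc a) v) xs       ≤⟨ count-∪ _ _ xs ⟩
    count (Q? zero) xs + count (λ v → any? λ a → Q? (suc a) v) xs
                                                              ≤⟨ +-mono-≤ (bound zero) (count-∃ (Q? ∘ suc) xs (bound ∘ suc)) ⟩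
    B + m * B                                                 ∎
    where
    open ≤-Reasoning
    split : (λ v → ∃ λ a → Q a v) ⊆ (Q zero ∪ λ v → ∃ λ a → Q (suc a) v)
    split (zero , q)  = inj₁ q
    split (suc a , q) = inj₂ (a , q)

∃¬-if-count< : ∀ {n} {P : Pred (Fin n) 0ℓ} (P? : Decidable P) →
               count P? (allFin n) < n → ∃ λ v → ¬ P v
∃¬-if-count< {n} P? count<n = ¬∀⟶∃¬ n _ P? λ ∀P →
  let all = filter-all P? {allFin n} (All.tabulate λ {v} _ → ∀P v) in
  <-irrefl (trans (cong length all) (length-tabulate {n = n} (λ v → v))) count<n

unique⇒lookup-injective : ∀ {A : Set} {xs : List A} → Unique xs → Injective _≡_ _≡_ (lookup xs)
unique⇒lookup-injective (_ ∷ _) {zero} {zero} _ = refl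
unique⇒lookup-injective (x∉xs ∷ _) {zero} {suc j} x≡xⱼ = ⊥-elim (All.lookup x∉xs (∈-lookup j) x≡xⱼ)
unique⇒lookup-injective (x∉xs ∷ _) {suc i} {zero} xᵢ≡x = ⊥-elim (All.lookup x∉xs (∈-lookup i) (sym xᵢ≡x))
unique⇒lookup-injective (_ ∷ xs!) {suc i} {suc j} xᵢ≡xⱼ = cong suc (unique⇒lookup-injective xs! xᵢ≡xⱼ)

embed-filter : ∀ {A : Set} {P : Pred A 0ℓ} (P? : Decidable P) {t} {xs : List A} → Unique xs →
               t ≤ count P? xs → Σ (Fin t → A) λ y → Injective _≡_ _≡_ y × (∀ k → P (y k))
embed-filter P? {xs = xs} xs! t≤ = y , y-injective , λ k → All.lookup (all-filter P? xs) (∈-lookup _)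
  where
  y : Fin _ → _
  y k = lookup (filter P? xs) (inject≤ k t≤)
  y-injective : Injective _≡_ _≡_ y
  y-injective = inject≤-injective t≤ t≤ _ _ ∘ unique⇒lookup-injective (Unique.filter⁺ P? xs!)

module _ {n₁ n₂ r : ℕ} (c : Colouring n₁ n₂ r) (x : Fin 2 → Fin n₁) where

  SameColour : Pred (Fin n₂) 0ℓ
  SameColour v = c (x zero) v ≡ c (x (suc zero)) v

  RepeatsColour : ∀ {k} → (Fin k → Fin n₂) → Pred (Fin n₂) 0ℓ
  RepeatsColour y v = ∃ λ b → ∃ λ p → ∃ λ q → c (x p) v ≡ c (x q) (y b)

  -- Taking p = q shows that every y b is blocked, so an unblocked vertex is new.
  Blocked : ∀ {k} → (Fin k → Fin n₂) → Pred (Fin n₂) 0ℓ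
  Blocked y = SameColour ∪ RepeatsColour y

  sameColour? : Decidable SameColour
  sameColour? v = c (x zero) v ≟ c (x (suc zero)) v

  repeatsColour? : ∀ {k} (y : Fin k → Fin n₂) → Decidable (RepeatsColour y)
  repeatsColour? y v = any? λ b → any? λ p → any? λ q → c (x p) v ≟ c (x q) (y b)

  blocked? : ∀ {k} (y : Fin k → Fin n₂) → Decidable (Blocked y)
  blocked? y = sameColour? ∪? repeatsColour? y

  rainbow-extend : ∀ {k} {y : Fin k → Fin n₂} {v} → Rainbow (edgesUV c x y) → ¬ Blocked y v →
                   Rainbow (edgesUV c x (v Vector.∷ y))
  rainbow-extend _  _       zero       zero zero       zero    _ = refl , refl
  rainbow-extend _  _       (suc zero) zero (suc zero) zero    _ = refl , refl
  rainbow-extend _  blocked zero       zero (suc zero) zero    e = ⊥-elim (blocked (inj₁ e))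
  rainbow-extend _  blocked (suc zero) zero zero       zero    e = ⊥-elim (blocked (inj₁ (sym e)))
  rainbow-extend _  blocked p          zero q          (suc b) e = ⊥-elim (blocked (inj₂ (b , p , q , e)))
  rainbow-extend _  blocked p          (suc a) q       zero    e = ⊥-elim (blocked (inj₂ (a , q , p , sym e)))
  rainbow-extend rb _       p          (suc a) q       (suc b) e = Product.map₂ (cong suc) (rb p a q b e)

  rainbow⇒injective : ∀ {k} {y : Fin k → Fin n₂} → Rainbow (edgesUV c x y) → Injective _≡_ _≡_ y
  rainbow⇒injective rb yₐ≡y_b = proj₂ (rb zero _ zero _ (cong (c (x zero)) yₐ≡y_b))

  repeatsColour-count : ∀ {B} → (∀ p col → colDeg c (x p) col ≤ B) →
                        ∀ {k} (y : Fin k → Fin n₂) → count (repeatsColour? y) (allFin n₂) ≤ k * (4 * B)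
  repeatsColour-count {B} colDeg≤B {k} y =
    subst (λ m → count (repeatsColour? y) (allFin n₂) ≤ k * m) (sym (*-assoc 2 2 B))
      (count-∃ _ (allFin n₂) λ b → count-∃ _ (allFin n₂) λ p → count-∃ _ (allFin n₂) λ q →
        colDeg≤B p (c (x q) (y b)))

  module _ {s : ℕ} (noK₂ₜ : NoMonoNoRainbowK2t (suc s) c) (x-injective : Injective _≡_ _≡_ x) where

    commonColour-count : ∀ col →
      count (λ v → (c (x zero) v ≟ col) ×-dec (c (x (suc zero)) v ≟ col)) (allFin n₂) ≤ s
    commonColour-count col = ≮⇒≥ λ s<count →
      let y , y-injective , commonColour = embed-filter _ (allFin⁺ n₂) s<count in
      proj₁ (proj₁ noK₂ₜ x y x-injective y-injective)
        (col , λ { zero k → proj₁ (commonColour k) ; (suc zero) k → proj₂ (commonColour k) })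

    sameColour-count : count sameColour? (allFin n₂) ≤ r * s
    sameColour-count = ≤-trans (count-mono _ _ (λ {v} e → c (x zero) v , refl , sym e) (allFin n₂))
                               (count-∃ _ (allFin n₂) commonColour-count)

    module _ {B : ℕ} (colDeg≤B : ∀ p col → colDeg c (x p) col ≤ B) where

      blocked-count : ∀ {k} (y : Fin k → Fin n₂) → count (blocked? y) (allFin n₂) ≤ r * s + k * (4 * B)
      blocked-count y = ≤-trans (count-∪ _ _ (allFin n₂))
                                (+-mono-≤ sameColour-count (repeatsColour-count colDeg≤B y))

      grow-rainbow : r * s + s * (4 * B) < n₂ →
                     ∀ k → k ≤ suc s → Σ (Fin k → Fin n₂) λ y → Rainbow (edgesUV c x y)
      grow-rainbow _ zero _ = (λ ()) , λ _ ()
      grow-rainbow room (suc k) (s≤s k≤s) =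
        let y , rainbow = grow-rainbow room k (m≤n⇒m≤1+n k≤s)
            few-blocked = ≤-<-trans (blocked-count y)
                            (≤-<-trans (+-monoʳ-≤ (r * s) (*-monoˡ-≤ (4 * B) k≤s)) room)
            v , unblocked = ∃¬-if-count< (blocked? y) few-blocked
        in v Vector.∷ y , rainbow-extend rainbow unblocked

      bounded-colDeg⇒n₂≤ : n₂ ≤ r * s + s * (4 * B)
      bounded-colDeg⇒n₂≤ = ≮⇒≥ λ room →
        let y , rainbow = grow-rainbow room (suc s) ≤-refl in
        proj₂ (proj₁ noK₂ₜ x y x-injective (rainbow⇒injective rainbow)) rainbow

module _ (s r n : ℕ) .{{_ : NonZero s}} where

  private instance
    4s≢0 : NonZero (4 * s)
    4s≢0 = m*n≢0 4 s

  -- ⌊(n - s(r+1) - 1) / 4s⌋: the largest integer strictly below (n - s(r+1)) / 4s.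
  colDegThreshold : ℕ
  colDegThreshold = (n ∸ suc (s * (r + 1))) / (4 * s)

  ≤colDegThreshold : ∀ d → 4 * s * d + s * (r + 1) < n → d ≤ colDegThreshold
  ≤colDegThreshold d bound = begin
    d                                     ≡⟨ m*n/n≡m d (4 * s) ⟨
    d * (4 * s) / (4 * s)                 ≤⟨ /-monoˡ-≤ (4 * s) (m+n≤o⇒m≤o∸n (d * (4 * s)) bound′) ⟩
    colDegThreshold                       ∎
    where
    open ≤-Reasoning
    bound′ : d * (4 * s) + suc (s * (r + 1)) ≤ n
    bound′ = subst (_≤ n) (trans (sym (+-suc _ _)) (cong (_+ suc (s * (r + 1))) (*-comm (4 * s) d))) bound

  colDegThreshold-room : s * (r + 1) < n → r * s + s * (4 * colDegThreshold) < n
  colDegThreshold-room s[r+1]<n = begin-strict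
    r * s + s * (4 * colDegThreshold)     ≡⟨ cong (r * s +_) (reorder s colDegThreshold) ⟩
    r * s + colDegThreshold * (4 * s)     ≤⟨ +-monoʳ-≤ (r * s) (m/n*n≤m _ (4 * s)) ⟩
    r * s + (n ∸ suc (s * (r + 1)))       <⟨ +-monoˡ-< _ (s≤s rs≤s[r+1]) ⟩
    suc (s * (r + 1)) + (n ∸ suc (s * (r + 1)))  ≡⟨ m+[n∸m]≡n s[r+1]<n ⟩
    n                                     ∎
    where
    open ≤-Reasoning
    reorder : ∀ s b → s * (4 * b) ≡ b * (4 * s)
    reorder = solve-∀
    rs≤s[r+1] : r * s ≤ s * (r + 1)
    rs≤s[r+1] = ≤-trans (≤-reflexive (*-comm r s)) (*-monoʳ-≤ s (m≤m+n r 1))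

pair-injective : ∀ {n} {i j : Fin n} → i ≢ j → Injective _≡_ _≡_ (i Vector.∷ j Vector.∷ Vector.[])
pair-injective _   {zero}     {zero}     _   = refl
pair-injective _   {suc zero} {suc zero} _   = refl
pair-injective i≢j {zero}     {suc zero} i≡j = contradiction i≡j i≢j
pair-injective i≢j {suc zero} {zero}     j≡i = contradiction (sym j≡i) i≢j

corollary1 : (t r n₁ n₂ : ℕ) → 2 ≤ t → 1 ≤ r → 1 ≤ n₁ → 1 ≤ n₂ →
    (c : Colouring n₁ n₂ r) → NoMonoNoRainbowK2t t c →
    (i j : Fin n₁) →
    (∀ col → 4 * (t ∸ 1) * colDeg c i col + (t ∸ 1) * (r + 1) < n₂) →
    (∀ col → 4 * (t ∸ 1) * colDeg c j col + (t ∸ 1) * (r + 1) < n₂) →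
    i ≡ j
corollary1 (suc s@(suc _)) r n₁ n₂ (s≤s (s≤s _)) (s≤s _) _ _ c noK₂ₜ i j Hi Hj with i ≟ j
... | yes i≡j = i≡j
... | no i≢j  = contradiction
  (bounded-colDeg⇒n₂≤ c x noK₂ₜ (pair-injective i≢j) colDeg≤B)
  (<⇒≱ (colDegThreshold-room s r n₂ (≤-<-trans (m≤n+m _ _) (Hi zero))))
  where
  x : Fin 2 → Fin n₁
  x = i Vector.∷ j Vector.∷ Vector.[]
  colDeg≤B : ∀ p col → colDeg c (x p) col ≤ colDegThreshold s r n₂
  colDeg≤B zero       col = ≤colDegThreshold s r n₂ _ (Hi col)
  colDeg≤B (suc zero) col = ≤colDegThreshold s r n₂ _ (Hj col)
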